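{- Let $\lambda=(\lambda_1,\lambda_2)$ be a strict partition of length $2$ with $\lambda_1$ and $\lambda_2$ both odd. Then $\langle\lambda\rangle(\lambda)=-1$, i.e. the value of the irreducible spin character $\langle\lambda\rangle$ at the class of cycle type $\lambda$ is $-1$.
   Context: For a strict partition $\lambda$ of $n$, $\langle\lambda\rangle$ denotes the character of the irreducible projective (spin) representation of the symmetric group $S_n$ indexed by $\lambda$, evaluated at partitions $\pi$ of $n$ into odd parts. By Morris's rule, $\langle\lambda\rangle(\pi)=\sum_T wt(T)$, summed over bar tableaux $T$ of shape $\lambda$ and type $\pi$, where: the shifted diagram $S(\lambda)$ shifts row $i$ of the Young diagram $i-1$ squares right; a bar tableau is a filling of $S(\lambda)$ by positive integers with weakly increasing rows, each occurring integer occurring an odd number of times, each integer in at most two rows and, if in two rows, both rows beginning with it, and such that for each $i$ the row lengths after deleting entries $>i$ are distinct; type $\pi$ means exactly $\pi_i$ entries equal $i$. The weight is defined recursively: $wt(\emptyset)=1$; for odd $r$ and $\lambda$ of length $k$ ($\lambda_{k+1}=0$), let $I_+=\{i:\lambda_{j+1}<\lambda_i-r<\lambda_j$ for some $j\le k\}$ (bar = rightmost $r$ squares of row $i$), $I_0=\{i:\lambda_i=r\}$ (bar = row $i$), $I_-=\{i:r-\lambda_i=\lambda_j, j>i\}$ (bar = rows $i$ and $j$); if the largest entries of $T$ form the bar associated with $i$ and $T'$ is $T$ with it removed, $wt(T)=n_i\,wt(T')$ with $n_i=(-1)^{j-i}2^{1-\varepsilon(\lambda)}$ ($i\in I_+$),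 $(-1)^{\ell(\lambda)-i}$ ($i\in I_0$), $(-1)^{j-i+\lambda_i}2^{1-\varepsilon(\lambda)}$ ($i\in I_-$), where $\varepsilon(\lambda)\in\{0,1\}$ is the parity of the number of even parts of $\lambda$. -}

module Defs where

open import Data.Nat using (ℕ; zero; suc; _∸_; _<ᵇ_; _≡ᵇ_; _%_; _+_)
open import Data.Bool using (Bool; true; false; if_then_else_; _∧_; _∨_; not)
open import Data.List using (List; []; _∷_; length; map; foldr; concatMap; reverse; filter; upTo)
open import Data.Integer using (ℤ; +_; -_) renaming (_+_ to _+ℤ_; _*_ to _*ℤ_)

-- Partitions are lists of parts (strict partitions: strictly decreasing
-- positive parts).  Rows are indexed 1..k as in the paper.

-- λ_i (1-based); returns 0 out of range, so λ_{k+1} = 0 as in the paper.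
part : List ℕ → ℕ → ℕ
part []       _             = 0
part (x ∷ xs) zero          = 0
part (x ∷ xs) (suc zero)    = x
part (x ∷ xs) (suc (suc i)) = part xs (suc i)

removeRow : ℕ → List ℕ → List ℕ
removeRow _             []       = []
removeRow zero          xs       = xs
removeRow (suc zero)    (x ∷ xs) = xs
removeRow (suc (suc i)) (x ∷ xs) = x ∷ removeRow (suc i) xs

insertDesc : ℕ → List ℕ → List ℕ
insertDesc v []       = v ∷ []
insertDesc v (x ∷ xs) = if v <ᵇ x then x ∷ insertDesc v xs else v ∷ x ∷ xs

rows : List ℕ → List ℕ
rows lam = map suc (upTo (length lam))

sumℤ : List ℤ → ℤ
sumℤ = foldr _+ℤ_ (+ 0)

sgn : ℕ → ℤ
sgn n = if n % 2 ≡ᵇ 0 then + 1 else - (+ 1)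

countEven : List ℕ → ℕ
countEven []       = 0
countEven (x ∷ xs) = (if x % 2 ≡ᵇ 0 then 1 else 0) + countEven xs

ε : List ℕ → ℕ
ε lam = countEven lam % 2

twoPow : List ℕ → ℤ
twoPow lam = if ε lam ≡ᵇ 0 then + 2 else + 1

-- Morris's rule, recursive form: the sum over bar tableaux of shape λ
-- whose largest entries are removed first.  The list of bar lengths is
-- given in the order in which bars are removed (last part of π first).
charRev : List ℕ → List ℕ → ℤ
charRev lam []      = if length lam ≡ᵇ 0 then + 1 else + 0
charRev lam (r ∷ ρ) = sumℤ plus +ℤ (sumℤ zero' +ℤ sumℤ minus)
  where
  k = length lam
  plus : List ℤ
  plus = concatMap (λ i → concatMap (λ j →
           let v = part lam i ∸ r in
           if (r <ᵇ part lam i) ∧ (part lam (suc j) <ᵇ v) ∧ (v <ᵇ part lam j)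
           then (sgn (j ∸ i) *ℤ twoPow lam
                  *ℤ charRev (insertDesc v (removeRow i lam)) ρ) ∷ []
           else []) (rows lam)) (rows lam)
  zero' : List ℤ
  zero' = concatMap (λ i →
           if part lam i ≡ᵇ r
           then (sgn (k ∸ i) *ℤ charRev (removeRow i lam) ρ) ∷ []
           else []) (rows lam)
  minus : List ℤ
  minus = concatMap (λ i → concatMap (λ j →
           if (i <ᵇ j) ∧ (part lam i <ᵇ r) ∧ ((r ∸ part lam i) ≡ᵇ part lam j)
           then (sgn ((j ∸ i) + part lam i) *ℤ twoPow lam
                  *ℤ charRev (removeRow i (removeRow j lam)) ρ) ∷ []
           else []) (rows lam)) (rows lam)

-- ⟨λ⟩(π) for π = (π_1, π_2, ..., π_m): the entries m (π_m of them) form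
-- the first bar removed, so bars are removed in the order reverse π.
spinChar : List ℕ → List ℕ → ℤ
spinChar lam π = charRev lam (reverse π)

-- By Morris's rule, ⟨a, b⟩(a, b) first removes a bar of length b from (a, b).
-- There are two: row 2 itself (I₀, weight 1, leaving (a), whose character
-- at (a) is 1), and the last b squares of row 1 (I₊, weight ±2 as both parts
-- are odd, leaving {b, c} with c = a − b even and c ≠ b).  The remaining
-- shape has a single bar of length a, covering both rows (I₋), of weight ±1.
-- In both orders of b and c the two signs multiply to −1, so the value is
-- −2 + 1 = −1.
module Submission where

open import Defs
open import Data.Nat using (ℕ; suc; _+_; _%_; _<_; _≤_; s≤s; _<ᵇ_; _≡ᵇ_)
open import Data.Nat.Properties
  using ( ≡ᵇ⇒≡; ≡⇒≡ᵇ; <ᵇ-reflects-<; ≤⇒≯; ≤-refl; <⇒≤; <⇒≢; >⇒≢; <-cmp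
        ; m≤m+n; m≤n+m; m<m+n; m<n+m; m<n⇒0<n; m+n∸m≡n; +-comm; +-identityʳ
        ; +-cancelˡ-<; m≤n⇒∃[o]m+o≡n )
open import Data.Nat.DivMod using (m%n<n; %-distribˡ-+)
open import Data.Bool using (true; false)
open import Data.List using ([]; _∷_)
open import Data.Product using (_,_)
open import Data.Integer using (-_; +_) renaming (_+_ to _+ℤ_; _*_ to _*ℤ_)
open import Data.Integer.Tactic.RingSolver using (solve-∀)
open import Relation.Binary.PropositionalEquality
open import Relation.Binary.Definitions using (tri<; tri≈; tri>)
open import Relation.Nullary.Negation using (contradiction)
open import Relation.Nullary.Reflects using (Reflects; ofʸ; ofⁿ; det; fromEquivalence)

≡ᵇ-reflects-≡ : ∀ m n → Reflects (m ≡ n) (m ≡ᵇ n)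
≡ᵇ-reflects-≡ m n = fromEquivalence (≡ᵇ⇒≡ m n) (≡⇒≡ᵇ m n)

≡ᵇ-refl : ∀ n → (n ≡ᵇ n) ≡ true
≡ᵇ-refl n = det (≡ᵇ-reflects-≡ n n) (ofʸ refl)

≡ᵇ-false : ∀ {m n} → m ≢ n → (m ≡ᵇ n) ≡ false
≡ᵇ-false {m} {n} m≢n = det (≡ᵇ-reflects-≡ m n) (ofⁿ m≢n)

<ᵇ-true : ∀ {m n} → m < n → (m <ᵇ n) ≡ true
<ᵇ-true {m} {n} m<n = det (<ᵇ-reflects-< m n) (ofʸ m<n)

<ᵇ-false : ∀ {m n} → n ≤ m → (m <ᵇ n) ≡ false
<ᵇ-false {m} {n} n≤m = det (<ᵇ-reflects-< m n) (ofⁿ (≤⇒≯ n≤m))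

odd+even-odd : ∀ m n → m % 2 ≡ 1 → n % 2 ≡ 0 → (m + n) % 2 ≡ 1
odd+even-odd m n m-odd n-even =
  trans (%-distribˡ-+ m n 2) (cong₂ (λ r s → (r + s) % 2) m-odd n-even)

odd+n-odd⇒n-even : ∀ m n → m % 2 ≡ 1 → (m + n) % 2 ≡ 1 → n % 2 ≡ 0
odd+n-odd⇒n-even m n m-odd m+n-odd = remainder-zero (m%n<n n 2)
  (trans (cong (λ r → (r + n % 2) % 2) (sym m-odd)) (trans (sym (%-distribˡ-+ m n 2)) m+n-odd))
  where
  remainder-zero : ∀ {r} → r < 2 → (1 + r) % 2 ≡ 1 → r ≡ 0
  remainder-zero {0}           _               _ = refl
  remainder-zero {1}           _               ()
  remainder-zero {suc (suc _)} (s≤s (s≤s ())) _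

sgn-suc : ∀ n → sgn (suc n) ≡ - sgn n
sgn-suc 0             = refl
sgn-suc 1             = refl
sgn-suc (suc (suc n)) = sgn-suc n

sgn-even : ∀ n → n % 2 ≡ 0 → sgn n ≡ + 1
sgn-even n n-even rewrite n-even = refl

sgn-odd : ∀ n → n % 2 ≡ 1 → sgn n ≡ - + 1
sgn-odd n n-odd rewrite n-odd = refl

twoPow-odd∷odd : ∀ x y → x % 2 ≡ 1 → y % 2 ≡ 1 → twoPow (x ∷ y ∷ []) ≡ + 2
twoPow-odd∷odd x y x-odd y-odd rewrite x-odd | y-odd = refl

twoPow-odd∷even : ∀ x y → x % 2 ≡ 1 → y % 2 ≡ 0 → twoPow (x ∷ y ∷ []) ≡ + 1
twoPow-odd∷even x y x-odd y-even rewrite x-odd | y-even = refl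

twoPow-even∷odd : ∀ x y → x % 2 ≡ 0 → y % 2 ≡ 1 → twoPow (x ∷ y ∷ []) ≡ + 1
twoPow-even∷odd x y x-even y-odd rewrite x-even | y-odd = refl

-- In the lemmas below the rewrites decide every membership test for I₊, I₀
-- and I₋; what is left is the sum I₊ +ℤ (I₀ +ℤ I₋) of the surviving terms.

charRev-singleRow : ∀ r → charRev (r ∷ []) (r ∷ []) ≡ + 1
charRev-singleRow r rewrite <ᵇ-false (≤-refl {r}) | ≡ᵇ-refl r = refl

charRev-doubleBar : ∀ {x y} → 0 < x → 0 < y →
  charRev (x ∷ y ∷ []) (x + y ∷ []) ≡ sgn (suc x) *ℤ twoPow (x ∷ y ∷ [])
charRev-doubleBar {x} {y} 0<x 0<y
  rewrite <ᵇ-false (m≤m+n x y) | <ᵇ-false (m≤n+m y x)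
        | ≡ᵇ-false (<⇒≢ (m<m+n x 0<y)) | ≡ᵇ-false (<⇒≢ (m<n+m y 0<x))
        | <ᵇ-true (m<m+n x 0<y) | m+n∸m≡n x y | ≡ᵇ-refl y
        = only-I₋ (sgn (suc x) *ℤ twoPow (x ∷ y ∷ []))
  where
  only-I₋ : ∀ t → + 0 +ℤ (+ 0 +ℤ (t *ℤ + 1 +ℤ + 0)) ≡ t
  only-I₋ = solve-∀

charRev-λ₂Bar-below : ∀ {b c} ρ → 0 < c → c < b →
  charRev (b + c ∷ b ∷ []) (b ∷ ρ)
    ≡ - (twoPow (b + c ∷ b ∷ []) *ℤ charRev (b ∷ c ∷ []) ρ) +ℤ charRev (b + c ∷ []) ρ
charRev-λ₂Bar-below {b} {c} ρ 0<c c<b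
  rewrite <ᵇ-true (m<m+n b 0<c) | m+n∸m≡n b c
        | <ᵇ-false (<⇒≤ c<b) | <ᵇ-true 0<c | <ᵇ-true c<b | <ᵇ-false (≤-refl {b})
        | ≡ᵇ-false (>⇒≢ (m<m+n b 0<c)) | ≡ᵇ-refl b | <ᵇ-false (m≤m+n b c)
        = I₊-and-I₀ (twoPow (b + c ∷ b ∷ [])) (charRev (b ∷ c ∷ []) ρ) (charRev (b + c ∷ []) ρ)
  where
  I₊-and-I₀ : ∀ t x y → (- + 1 *ℤ t *ℤ x +ℤ + 0) +ℤ ((+ 1 *ℤ y +ℤ + 0) +ℤ + 0) ≡ - (t *ℤ x) +ℤ y
  I₊-and-I₀ = solve-∀

charRev-λ₂Bar-above : ∀ {b c} ρ → 0 < b → b < c →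
  charRev (b + c ∷ b ∷ []) (b ∷ ρ)
    ≡ twoPow (b + c ∷ b ∷ []) *ℤ charRev (c ∷ b ∷ []) ρ +ℤ charRev (b + c ∷ []) ρ
charRev-λ₂Bar-above {b} {c} ρ 0<b b<c
  rewrite <ᵇ-true (m<m+n b (m<n⇒0<n b<c)) | m+n∸m≡n b c
        | <ᵇ-true b<c | <ᵇ-true (m<n+m c 0<b) | <ᵇ-true (m<n⇒0<n b<c)
        | <ᵇ-false (<⇒≤ b<c) | <ᵇ-false (≤-refl {b})
        | ≡ᵇ-false (>⇒≢ (m<m+n b (m<n⇒0<n b<c))) | ≡ᵇ-refl b | <ᵇ-false (m≤m+n b c)
        = I₊-and-I₀ (twoPow (b + c ∷ b ∷ [])) (charRev (c ∷ b ∷ []) ρ) (charRev (b + c ∷ []) ρ)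
  where
  I₊-and-I₀ : ∀ t x y → (+ 1 *ℤ t *ℤ x +ℤ + 0) +ℤ ((+ 1 *ℤ y +ℤ + 0) +ℤ + 0) ≡ t *ℤ x +ℤ y
  I₊-and-I₀ = solve-∀

spinChar-oddPair-below : ∀ {b c} → 0 < c → c < b → b % 2 ≡ 1 → c % 2 ≡ 0 →
  spinChar (b + c ∷ b ∷ []) (b + c ∷ b ∷ []) ≡ - + 1
spinChar-oddPair-below {b} {c} 0<c c<b b-odd c-even = begin
  spinChar (b + c ∷ b ∷ []) (b + c ∷ b ∷ [])
    ≡⟨ charRev-λ₂Bar-below (b + c ∷ []) 0<c c<b ⟩
  - (twoPow (b + c ∷ b ∷ []) *ℤ charRev (b ∷ c ∷ []) (b + c ∷ [])) +ℤ charRev (b + c ∷ []) (b + c ∷ [])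
    ≡⟨ cong₂ _+ℤ_ (cong₂ (λ t x → - (t *ℤ x))
                          (twoPow-odd∷odd (b + c) b (odd+even-odd b c b-odd c-even) b-odd) doubleBar)
                  (charRev-singleRow (b + c)) ⟩
  - (+ 2 *ℤ + 1) +ℤ + 1
    ∎
  where
  open ≡-Reasoning
  doubleBar : charRev (b ∷ c ∷ []) (b + c ∷ []) ≡ + 1
  doubleBar = begin
    charRev (b ∷ c ∷ []) (b + c ∷ [])   ≡⟨ charRev-doubleBar (m<n⇒0<n c<b) 0<c ⟩
    sgn (suc b) *ℤ twoPow (b ∷ c ∷ [])  ≡⟨ cong₂ _*ℤ_ (trans (sgn-suc b) (cong -_ (sgn-odd b b-odd)))
                                                     (twoPow-odd∷even b c b-odd c-even) ⟩
    + 1 *ℤ + 1                          ∎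

spinChar-oddPair-above : ∀ {b c} → 0 < b → b < c → b % 2 ≡ 1 → c % 2 ≡ 0 →
  spinChar (b + c ∷ b ∷ []) (b + c ∷ b ∷ []) ≡ - + 1
spinChar-oddPair-above {b} {c} 0<b b<c b-odd c-even = begin
  spinChar (b + c ∷ b ∷ []) (b + c ∷ b ∷ [])
    ≡⟨ charRev-λ₂Bar-above (b + c ∷ []) 0<b b<c ⟩
  twoPow (b + c ∷ b ∷ []) *ℤ charRev (c ∷ b ∷ []) (b + c ∷ []) +ℤ charRev (b + c ∷ []) (b + c ∷ [])
    ≡⟨ cong₂ _+ℤ_ (cong₂ _*ℤ_
                          (twoPow-odd∷odd (b + c) b (odd+even-odd b c b-odd c-even) b-odd) doubleBar)
                  (charRev-singleRow (b + c)) ⟩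
  + 2 *ℤ - + 1 +ℤ + 1
    ∎
  where
  open ≡-Reasoning
  doubleBar : charRev (c ∷ b ∷ []) (b + c ∷ []) ≡ - + 1
  doubleBar = begin
    charRev (c ∷ b ∷ []) (b + c ∷ [])   ≡⟨ cong (λ n → charRev (c ∷ b ∷ []) (n ∷ [])) (+-comm b c) ⟩
    charRev (c ∷ b ∷ []) (c + b ∷ [])   ≡⟨ charRev-doubleBar (m<n⇒0<n b<c) 0<b ⟩
    sgn (suc c) *ℤ twoPow (c ∷ b ∷ [])  ≡⟨ cong₂ _*ℤ_ (trans (sgn-suc c) (cong -_ (sgn-even c c-even)))
                                                     (twoPow-even∷odd c b c-even b-odd) ⟩
    - + 1 *ℤ + 1                        ∎

spinChar-oddPair : ∀ {b c} → 0 < b → 0 < c → b % 2 ≡ 1 → c % 2 ≡ 0 →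
  spinChar (b + c ∷ b ∷ []) (b + c ∷ b ∷ []) ≡ - + 1
spinChar-oddPair {b} {c} 0<b 0<c b-odd c-even with <-cmp c b
... | tri< c<b _ _ = spinChar-oddPair-below 0<c c<b b-odd c-even
... | tri≈ _ c≡b _ = contradiction (trans (sym c-even) (trans (cong (_% 2) c≡b) b-odd)) λ ()
... | tri> _ _ b<c = spinChar-oddPair-above 0<b b<c b-odd c-even

mainTheorem3 : (a b : ℕ) → 0 < b → b < a → a % 2 ≡ 1 → b % 2 ≡ 1 →
    spinChar (a ∷ b ∷ []) (a ∷ b ∷ []) ≡ - (+ 1)
mainTheorem3 a b 0<b b<a a-odd b-odd with m≤n⇒∃[o]m+o≡n (<⇒≤ b<a)
... | c , refl = spinChar-oddPair 0<b 0<c b-odd (odd+n-odd⇒n-even b c b-odd a-odd)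
  where
  0<c : 0 < c
  0<c = +-cancelˡ-< b 0 c (subst (_< b + c) (sym (+-identityʳ b)) b<a)
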